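{- Let $V=(v_1,\dots,v_{J+1})\in M^*$ and write $\pi(V)=(v_1^*,\dots,v_{I+1}^*)$. Then $v_{j+1}^*>0$ for $0\le j<I$, $v_{I+1}^*\ge0$, and $\pi(V)\in M$.
   Context: $M$ is the set of integer vectors $(v_1,\dots,v_{J+1})$ with $J\ge1$ odd, $v_i\ge1$ for $1\le i\le J$, $v_{J+1}\ge0$; $M^*=\{V\in M: v_1>1\}$. Contraction: for $V\in M^*$ let $\tau(0)=0$, $\tau(r)=(v_1-1)+\cdots+(v_r-1)$ for $1\le r\le J+1$. For $0\le r\le J$ let $next(r)=r+2t+1$ where $t\ge0$ is maximal such that $r+2t\le J$ and $v_{r+2i}=1$ for $1\le i\le t$. Let $r_0=0$, $r_{j+1}=next(r_j)$, until $r_{I+1}=J+1$ (this defines $I$). Then $\pi(V)=(v_1^*,\dots,v_{I+1}^*)$ with $v_{j+1}^*=\tau(r_{j+1})-\tau(r_j)$ for $0\le j<I$ and $v_{I+1}^*=\tau(J+1)-\tau(r_I)+1$. -}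

module Defs where

open import Data.Nat as ℕ using (ℕ; zero; suc; _≤?_; _∸_)
open import Data.Integer as ℤ using (ℤ; +_; _-_; _≤_; _<_; _≟_)
open import Data.List using (List; []; _∷_; length)
open import Data.Product using (Σ; ∃; _×_)
open import Relation.Nullary using (yes; no)
open import Relation.Binary.PropositionalEquality using (_≡_)

-- Vectors (v_1,…,v_{J+1}) are represented as lists of integers.
-- 1-indexed access; out-of-range indices (never used) give 0.
vAt : List ℤ → ℕ → ℤ
vAt []       _             = + 0
vAt (x ∷ xs) zero          = + 0
vAt (x ∷ xs) (suc zero)    = x
vAt (x ∷ xs) (suc (suc n)) = vAt xs (suc n)

Odd : ℕ → Set
Odd J = ∃ λ k → J ≡ suc (2 ℕ.* k)

InM : List ℤ → Set
InM V = Σ ℕ λ J →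
    (length V ≡ suc J)
  × Odd J
  × (1 ℕ.≤ J)
  × (∀ i → 1 ℕ.≤ i → i ℕ.≤ J → + 1 ≤ vAt V i)
  × (+ 0 ≤ vAt V (suc J))

InMStar : List ℤ → Set
InMStar V = InM V × (+ 1 < vAt V 1)

Jof : List ℤ → ℕ
Jof V = length V ∸ 1

τ : List ℤ → ℕ → ℤ
τ V zero    = + 0
τ V (suc r) = τ V r ℤ.+ (vAt V (suc r) - + 1)

-- maximal t ≥ 0 with r + 2t ≤ J and v_{r+2i} = 1 for 1 ≤ i ≤ t
-- (computed as the length of the run, with fuel; fuel ≥ J suffices)
runLen : ℕ → List ℤ → ℕ → ℕ
runLen zero     V r = 0
runLen (suc f)  V r with r ℕ.+ 2 ≤? Jof V | vAt V (r ℕ.+ 2) ≟ + 1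
... | yes _ | yes _ = suc (runLen f V (r ℕ.+ 2))
... | _     | _     = 0

next : List ℤ → ℕ → ℕ
next V r = r ℕ.+ 2 ℕ.* runLen (length V) V r ℕ.+ 1

-- the sequence r_j, r_{j+1}, … starting from r, stopping at the first
-- value > J (which is J+1); fuel ≥ J + 2 suffices
steps : ℕ → List ℤ → ℕ → List ℕ
steps zero    V r = []
steps (suc f) V r with r ≤? Jof V
... | yes _ = r ∷ steps f V (next V r)
... | no  _ = r ∷ []

-- r_0 = 0, r_1, …, r_{I+1} = J + 1
rSeq : List ℤ → List ℕ
rSeq V = steps (suc (suc (length V))) V 0

diffs : List ℤ → List ℕ → List ℤ
diffs V (a ∷ b ∷ [])       = (τ V b - τ V a) ℤ.+ + 1
                             ∷ []
diffs V (a ∷ b ∷ c ∷ rest) = (τ V b - τ V a) ∷ diffs V (b ∷ c ∷ rest)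
diffs V _                  = []

π : List ℤ → List ℤ
π V = diffs V (rSeq V)

-- Consecutive contraction points satisfy r_j < r_{j+1} ≤ J, and v_{r_j + 1} > 1:
-- for r_0 = 0 this is v_1 > 1, and for r_{j+1} = r_j + 2t + 1 it is the
-- maximality of t.  As τ is nondecreasing on [0, J] and jumps at every such
-- r_j, the entries τ(r_{j+1}) - τ(r_j) are positive; the last one equals
-- τ(J) - τ(r_I) + v_{J+1} ≥ 0.  Each r_{j+1} - r_j is odd, so the even number
-- J + 1 is a sum of I + 1 odd numbers, which makes I + 1 even and I odd.
module Submission where

open import Defs
open import Data.Nat as ℕ using (ℕ; zero; suc; _∸_; z≤n; s≤s; _≤′_; ≤′-refl; ≤′-step; _≤?_)
import Data.Nat.Properties as ℕP
open import Data.Nat.Tactic.RingSolver using (solve-∀)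
open import Data.Integer as ℤ using (ℤ; +_; _-_; _≤_; _<_; _≟_)
import Data.Integer.Properties as ℤP
import Data.Integer.Tactic.RingSolver as ℤSolver
open import Data.List using (List; []; _∷_; length)
open import Data.Product using (_×_; ∃; _,_; proj₁; proj₂)
open import Data.Empty using (⊥-elim)
open import Relation.Nullary using (yes; no)
open import Relation.Binary.PropositionalEquality
  using (_≡_; _≢_; refl; sym; trans; cong; subst; module ≡-Reasoning)

m+2n≡2k⇒m≡2[k∸n] : ∀ m n k → m ℕ.+ 2 ℕ.* n ≡ 2 ℕ.* k → m ≡ 2 ℕ.* (k ∸ n)
m+2n≡2k⇒m≡2[k∸n] m n k eq = begin
  m                          ≡⟨ ℕP.m+n∸n≡m m (2 ℕ.* n) ⟨
  m ℕ.+ 2 ℕ.* n ∸ 2 ℕ.* n    ≡⟨ cong (_∸ 2 ℕ.* n) eq ⟩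
  2 ℕ.* k ∸ 2 ℕ.* n          ≡⟨ ℕP.*-distribˡ-∸ 2 k n ⟨
  2 ℕ.* (k ∸ n)              ∎
  where open ≡-Reasoning

i<j⇒0<j-i : ∀ {i j} → i < j → + 0 < j - i
i<j⇒0<j-i {i} {j} i<j = begin-strict
  + 0    ≡⟨ ℤP.+-inverseʳ i ⟨
  i - i  <⟨ ℤP.+-monoˡ-< (ℤ.- i) i<j ⟩
  j - i  ∎
  where open ℤP.≤-Reasoning

data PosExceptLast : List ℤ → Set where
  [_] : ∀ {x} → + 0 ≤ x → PosExceptLast (x ∷ [])
  _∷_ : ∀ {x xs} → + 0 < x → PosExceptLast xs → PosExceptLast (x ∷ xs)

PosExceptLast⇒init-pos : ∀ {D} → PosExceptLast D →
  ∀ j → j ℕ.< length D ∸ 1 → + 0 < vAt D (suc j)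
PosExceptLast⇒init-pos (x>0 ∷ _) zero    _  = x>0
PosExceptLast⇒init-pos (_   ∷ p) (suc j) lt = PosExceptLast⇒init-pos p j (ℕP.∸-monoˡ-< lt (s≤s z≤n))

PosExceptLast⇒last-nonneg : ∀ {D} → PosExceptLast D → + 0 ≤ vAt D (length D)
PosExceptLast⇒last-nonneg [ x≥0 ]           = x≥0
PosExceptLast⇒last-nonneg (_ ∷ [ x≥0 ])     = x≥0
PosExceptLast⇒last-nonneg (_ ∷ p@(_ ∷ _))   = PosExceptLast⇒last-nonneg p

PosExceptLast⇒InM : ∀ {D} m → PosExceptLast D → length D ≡ 2 ℕ.* m → InM D
PosExceptLast⇒InM zero [ _ ] ()
PosExceptLast⇒InM zero (_ ∷ _) ()
PosExceptLast⇒InM {D} (suc m) p len =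
  suc (2 ℕ.* m) , len′ , (m , refl) , s≤s z≤n , entries-pos , last-nonneg
  where
  len′ : length D ≡ suc (suc (2 ℕ.* m))
  len′ = trans len (ℕP.*-suc 2 m)
  entries-pos : ∀ i → 1 ℕ.≤ i → i ℕ.≤ suc (2 ℕ.* m) → + 1 ≤ vAt D i
  entries-pos (suc j) _ (s≤s j≤) =
    ℤP.i<j⇒suc[i]≤j (PosExceptLast⇒init-pos p j (subst (λ n → j ℕ.< n ∸ 1) (sym len′) (s≤s j≤)))
  last-nonneg : + 0 ≤ vAt D (suc (suc (2 ℕ.* m)))
  last-nonneg = subst (λ n → + 0 ≤ vAt D n) len′ (PosExceptLast⇒last-nonneg p)

length-diffs : ∀ V a L → length (diffs V (a ∷ L)) ≡ length L
length-diffs V a []            = refl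
length-diffs V a (b ∷ [])      = refl
length-diffs V a (b ∷ c ∷ L)   = cong suc (length-diffs V b (c ∷ L))

module _ (V : List ℤ) where

  private
    +2*suc : ∀ r t → r ℕ.+ 2 ℕ.* suc t ≡ r ℕ.+ 2 ℕ.+ 2 ℕ.* t
    +2*suc = solve-∀

  runLen-bound : ∀ f r → r ℕ.≤ Jof V → r ℕ.+ 2 ℕ.* runLen f V r ℕ.≤ Jof V
  runLen-bound zero r r≤J rewrite ℕP.+-identityʳ r = r≤J
  runLen-bound (suc f) r r≤J with r ℕ.+ 2 ≤? Jof V | vAt V (r ℕ.+ 2) ≟ + 1
  ... | yes r+2≤J | yes _ rewrite +2*suc r (runLen f V (r ℕ.+ 2)) = runLen-bound f (r ℕ.+ 2) r+2≤J
  ... | yes _     | no _  rewrite ℕP.+-identityʳ r = r≤J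
  ... | no _      | _     rewrite ℕP.+-identityʳ r = r≤J

  runLen-maximal : ∀ f r → Jof V ℕ.< r ℕ.+ 2 ℕ.* f →
    r ℕ.+ 2 ℕ.* runLen f V r ℕ.+ 2 ℕ.≤ Jof V → vAt V (r ℕ.+ 2 ℕ.* runLen f V r ℕ.+ 2) ≢ + 1
  runLen-maximal zero r J<r+0 r+0+2≤J = ⊥-elim (ℕP.<⇒≱ J<r+0 (ℕP.≤-trans (ℕP.m≤m+n _ 2) r+0+2≤J))
  runLen-maximal (suc f) r J<r+2f with r ℕ.+ 2 ≤? Jof V | vAt V (r ℕ.+ 2) ≟ + 1
  ... | yes _ | yes _ rewrite +2*suc r (runLen f V (r ℕ.+ 2)) =
    runLen-maximal f (r ℕ.+ 2) (subst (Jof V ℕ.<_) (+2*suc r f) J<r+2f)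
  ... | yes _ | no v≢1 rewrite ℕP.+-identityʳ r = λ _ → v≢1
  ... | no r+2≰J | _   rewrite ℕP.+-identityʳ r = λ r+2≤J → ⊥-elim (r+2≰J r+2≤J)

module Contraction (V : List ℤ)
  (J<length : Jof V ℕ.< length V)
  (v-pos : ∀ i → 1 ℕ.≤ i → i ℕ.≤ Jof V → + 1 ≤ vAt V i)
  (v-last : + 0 ≤ vAt V (suc (Jof V))) where

  J : ℕ
  J = Jof V

  run : ℕ → ℕ
  run r = runLen (length V) V r

  next≡ : ∀ r → next V r ≡ suc (r ℕ.+ 2 ℕ.* run r)
  next≡ r = ℕP.+-comm _ 1

  r<next : ∀ r → r ℕ.< next V r
  r<next r = subst (r ℕ.<_) (sym (next≡ r)) (s≤s (ℕP.m≤m+n r _))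

  next≤1+J : ∀ {r} → r ℕ.≤ J → next V r ℕ.≤ suc J
  next≤1+J {r} r≤J = subst (ℕ._≤ suc J) (sym (next≡ r)) (s≤s (runLen-bound V (length V) r r≤J))

  Heavy : ℕ → Set
  Heavy r = r ℕ.< J → + 1 < vAt V (suc r)

  next-heavy : ∀ r → Heavy (next V r)
  next-heavy r next<J = ℤP.≤∧≢⇒< (v-pos _ (s≤s z≤n) next<J) (λ 1≡v → v≢1 (sym 1≡v))
    where
    suc-next : suc (next V r) ≡ r ℕ.+ 2 ℕ.* run r ℕ.+ 2
    suc-next = sym (ℕP.+-suc (r ℕ.+ 2 ℕ.* run r) 1)
    J<r+2len : J ℕ.< r ℕ.+ 2 ℕ.* length V
    J<r+2len = ℕP.<-≤-trans J<length (ℕP.≤-trans (ℕP.m≤m+n (length V) _) (ℕP.m≤n+m _ r))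
    v≢1 : vAt V (suc (next V r)) ≢ + 1
    v≢1 = subst (λ i → vAt V i ≢ + 1) (sym suc-next)
      (runLen-maximal V (length V) r J<r+2len (subst (ℕ._≤ J) suc-next next<J))

  τ-mono : ∀ {a b} → a ≤′ b → b ℕ.≤ J → τ V a ≤ τ V b
  τ-mono ≤′-refl _ = ℤP.≤-refl
  τ-mono {a} {suc b} (≤′-step a≤′b) b<J =
    ℤP.≤-trans (τ-mono a≤′b (ℕP.<⇒≤ b<J))
      (ℤP.i≤i+j (τ V b) _ {{ℤ.nonNegative (ℤP.i≤j⇒0≤j-i (v-pos (suc b) (s≤s z≤n) b<J))}})

  τ-gap : ∀ {r b} → Heavy r → r ℕ.< b → b ℕ.≤ J → + 0 < τ V b - τ V r
  τ-gap {r} {b} heavy r<b b≤J = i<j⇒0<j-i (ℤP.<-≤-trans τr<τ[1+r] (τ-mono (ℕP.≤⇒≤′ r<b) b≤J))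
    where
    τr<τ[1+r] : τ V r < τ V (suc r)
    τr<τ[1+r] = subst (_< τ V (suc r)) (ℤP.+-identityʳ (τ V r))
      (ℤP.+-monoʳ-< (τ V r) (i<j⇒0<j-i (heavy (ℕP.<-≤-trans r<b b≤J))))

  τ-last : ∀ {r} → r ℕ.≤ J → + 0 ≤ τ V (suc J) - τ V r ℤ.+ + 1
  τ-last {r} r≤J = subst (+ 0 ≤_) (rearrange (τ V J) (vAt V (suc J)) (τ V r))
    (ℤP.+-mono-≤ (ℤP.i≤j⇒0≤j-i (τ-mono (ℕP.≤⇒≤′ r≤J) ℕP.≤-refl)) v-last)
    where
    rearrange : ∀ (t v s : ℤ) → (t - s) ℤ.+ v ≡ (t ℤ.+ (v - + 1)) - s ℤ.+ + 1
    rearrange = ℤSolver.solve-∀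

  -- Chain r L: L is r_{j+1}, …, r_{I+1} = J + 1 when r = r_j.
  data Chain : ℕ → List ℕ → Set where
    done : ∀ {r} → r ℕ.≤ J → next V r ≡ suc J → Chain r (suc J ∷ [])
    step : ∀ {r L} → r ℕ.≤ J → next V r ℕ.≤ J → Chain (next V r) L → Chain r (next V r ∷ L)

  chain-steps : ∀ f r → r ℕ.≤ J → J ℕ.< r ℕ.+ f → Chain r (steps f V (next V r))
  chain-steps zero r r≤J J<r+0 =
    ⊥-elim (ℕP.<⇒≱ (subst (J ℕ.<_) (ℕP.+-identityʳ r) J<r+0) r≤J)
  -- [steps] makes the same test, so both branches of the goal compute.
  chain-steps (suc f) r r≤J J<r+1+f with next V r ≤? J
  ... | yes next≤J = step r≤J next≤J (chain-steps f (next V r) next≤J J<next+f)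
    where
    J<next+f : J ℕ.< next V r ℕ.+ f
    J<next+f = ℕP.<-≤-trans (subst (J ℕ.<_) (ℕP.+-suc r f) J<r+1+f) (ℕP.+-monoˡ-≤ f (r<next r))
  ... | no next≰J = chain-done (ℕP.≤-antisym (next≤1+J r≤J) (ℕP.≰⇒> next≰J))
    where
    chain-done : next V r ≡ suc J → Chain r (next V r ∷ [])
    chain-done next≡1+J rewrite next≡1+J = done r≤J next≡1+J

  diffs-chain : ∀ {a b L} → Chain b L → diffs V (a ∷ b ∷ L) ≡ (τ V b - τ V a) ∷ diffs V (b ∷ L)
  diffs-chain (done _ _)     = refl
  diffs-chain (step _ _ _)   = refl

  chain-posExceptLast : ∀ {r L} → Chain r L → Heavy r → PosExceptLast (diffs V (r ∷ L))
  chain-posExceptLast (done r≤J _) _ = [ τ-last r≤J ]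
  chain-posExceptLast {r} (step r≤J next≤J c) heavy = subst PosExceptLast (sym (diffs-chain c))
    (τ-gap heavy (r<next r) next≤J ∷ chain-posExceptLast c (next-heavy r))

  chain-parity : ∀ {r L} → Chain r L → ∃ λ s → r ℕ.+ length L ℕ.+ 2 ℕ.* s ≡ suc J
  chain-parity {r} (done _ next≡1+J) = run r , trans (reorder r (run r)) next≡1+J
    where
    reorder : ∀ r t → r ℕ.+ 1 ℕ.+ 2 ℕ.* t ≡ r ℕ.+ 2 ℕ.* t ℕ.+ 1
    reorder = solve-∀
  chain-parity {r} (step {L = L} _ _ c) with chain-parity c
  ... | s , eq = run r ℕ.+ s , trans (reorder r (run r) (length L) s) eq
    where
    reorder : ∀ r t l s → r ℕ.+ suc l ℕ.+ 2 ℕ.* (t ℕ.+ s) ≡ r ℕ.+ 2 ℕ.* t ℕ.+ 1 ℕ.+ l ℕ.+ 2 ℕ.* s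
    reorder = solve-∀

  -- rSeq V computes to 0 ∷ rSeq-tail, so π V is diffs V (0 ∷ rSeq-tail).
  rSeq-tail : List ℕ
  rSeq-tail = steps (suc (length V)) V (next V 0)

  rSeq-chain : Chain 0 rSeq-tail
  rSeq-chain = chain-steps (suc (length V)) 0 z≤n (s≤s (ℕP.m∸n≤m (length V) 1))

  π-posExceptLast : + 1 < vAt V 1 → PosExceptLast (π V)
  π-posExceptLast v₁>1 = chain-posExceptLast rSeq-chain (λ _ → v₁>1)

  π-parity : ∃ λ s → length (π V) ℕ.+ 2 ℕ.* s ≡ suc J
  π-parity with chain-parity rSeq-chain
  ... | s , eq = s , trans (cong (ℕ._+ 2 ℕ.* s) (length-diffs V 0 rSeq-tail)) eq

proposition81p2 : (V : List ℤ) → InMStar V →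
    ((j : ℕ) → j ℕ.< length (π V) ∸ 1 → + 0 < vAt (π V) (suc j))
    × (+ 0 ≤ vAt (π V) (length (π V)))
    × InM (π V)
proposition81p2 V ((J , len , (k , J≡1+2k) , _ , v-pos , v-last) , v₁>1) =
  PosExceptLast⇒init-pos contracted ,
  PosExceptLast⇒last-nonneg contracted ,
  PosExceptLast⇒InM (suc k ∸ s) contracted (m+2n≡2k⇒m≡2[k∸n] (length (π V)) s (suc k) even)
  where
  Jof≡J : Jof V ≡ J
  Jof≡J = cong (_∸ 1) len
  open Contraction V
    (subst (λ n → n ∸ 1 ℕ.< n) (sym len) (ℕP.n<1+n J))
    (λ i 1≤i i≤J → v-pos i 1≤i (subst (i ℕ.≤_) Jof≡J i≤J))
    (subst (λ n → + 0 ≤ vAt V (suc n)) (sym Jof≡J) v-last)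
    using (π-posExceptLast; π-parity)
  contracted : PosExceptLast (π V)
  contracted = π-posExceptLast v₁>1
  s : ℕ
  s = proj₁ π-parity
  even : length (π V) ℕ.+ 2 ℕ.* s ≡ 2 ℕ.* suc k
  even = trans (proj₂ π-parity) (trans (cong suc (trans Jof≡J J≡1+2k)) (sym (ℕP.*-suc 2 k)))
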